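{- For each $n\in\mathbb N$ let $\mathcal P_n$ be an ordered partition of $\{0,1\}^n$ and let $B_n\in\mathcal P_n$ be a colour class with $|\mathrm{SP}(B_n)|$ maximal among the colour classes of $\mathcal P_n$. Assume: (1) every $v\in\{0,1\}^n$ occurs in at least one colour class of $\mathcal P_n$; (2) $\max_{C\in\mathcal P_n}|C|\in\mathcal O(n)$; (3) $|\mathrm{SP}(B_n)|\in o(n)$. Let $f(n)\in o(n)$ be such that $|\mathrm{SP}(C)|\le f(n)$ for all $C\in\mathcal P_n$ (for large $n$). Then for sufficiently large $n$, \[|\mathrm{Stab}_n(\mathcal P_n)|\le\big(f(n)!\big)^{n/(f(n)-1)}\cdot2^n\cdot(8\log n)!\,.\]
   Context: $[n]=\{1,\dots,n\}$, $\mathrm{Sym}_n$ the symmetric group on $[n]$, acting on $\{0,1\}^n$ by $\pi(v)=v_{\pi^{ -1}(1)}\cdots v_{\pi^{ -1}(n)}$, elementwise on sets and componentwise on tuples; $\mathrm{Stab}_n(x)=\{\pi\in\mathrm{Sym}_n:\pi(x)=x\}$. An ordered partition of $\{0,1\}^n$ is a tuple of pairwise disjoint nonempty sets (colour classes) with union $\{0,1\}^n$. A supporting partition of $G\le\mathrm{Sym}_n$ is a partition $\mathcal Q$ of $[n]$ such that every $\pi$ with $\pi(Q)=Q$ for all $Q\in\mathcal Q$ lies in $G$; $\mathrm{SP}(G)$ is the unique coarsest one, $\mathrm{SP}(C):=\mathrm{SP}(\mathrm{Stab}_n(C))$, and $|\mathrm{SP}(C)|$ is its number of parts. $\log$ is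 base $2$. -}

module Defs where

open import Data.Nat using (ℕ; zero; suc; _≤_; _+_; _*_)
open import Data.Bool using (Bool; true; false; _∧_; not; if_then_else_)
import Data.Bool.Properties as BoolP
open import Data.Fin using (Fin)
import Data.Fin as Fin
open import Data.Fin.Properties using () renaming (_≟_ to _≟F_)
open import Data.Vec using (Vec; []; _∷_; lookup; tabulate)
open import Data.List using (List; []; _∷_; length; filterᵇ; deduplicateᵇ; map; allFin; foldr; concatMap; applyUpTo)
open import Data.List.Membership.Propositional using (_∈_)
open import Data.List.Relation.Unary.All using (All)
open import Data.List.Relation.Unary.Any using (Any)
open import Data.List.Relation.Unary.AllPairs using (AllPairs)
open import Data.Empty using (⊥)
open import Data.Product using (Σ; _×_)
open import Relation.Binary.PropositionalEquality using (_≡_)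
open import Relation.Nullary.Decidable using (⌊_⌋)

Point : ℕ → Set
Point n = Vec Bool n

Colour : ℕ → Set
Colour n = Point n → Bool

-- A candidate permutation of [n] = Fin n, given by its table: π i = lookup π i.
Perm : ℕ → Set
Perm n = Vec (Fin n) n

allB : ∀ {A : Set} → (A → Bool) → List A → Bool
allB p = foldr (λ x b → p x ∧ b) true

_==B_ : Bool → Bool → Bool
a ==B b = ⌊ a BoolP.≟ b ⌋

_==F_ : ∀ {n} → Fin n → Fin n → Bool
i ==F j = ⌊ i ≟F j ⌋

allPoints : (n : ℕ) → List (Point n)
allPoints zero = [] ∷ []
allPoints (suc n) = concatMap (λ v → (false ∷ v) ∷ (true ∷ v) ∷ []) (allPoints n)

allVecs : (m k : ℕ) → List (Vec (Fin m) k)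
allVecs m zero = [] ∷ []
allVecs m (suc k) = concatMap (λ v → map (λ i → i ∷ v) (allFin m)) (allVecs m k)

isPerm : ∀ {n} → Perm n → Bool
isPerm {n} π = allB (λ i → allB (λ j → if lookup π i ==F lookup π j then i ==F j else true) (allFin n)) (allFin n)

findFirst : ∀ {n} → (Fin n → Bool) → Fin n → List (Fin n) → Fin n
findFirst p d [] = d
findFirst p d (j ∷ js) = if p j then j else findFirst p d js

inv : ∀ {n} → Perm n → Fin n → Fin n
inv {n} π i = findFirst (λ j → lookup π j ==F i) i (allFin n)

act : ∀ {n} → Perm n → Point n → Point n
act π v = tabulate (λ i → lookup v (inv π i))

fixesColour : ∀ {n} → Colour n → Perm n → Bool
fixesColour {n} C π = allB (λ v → C v ==B C (act π v)) (allPoints n)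

size : ∀ {n} → Colour n → ℕ
size {n} C = length (filterᵇ C (allPoints n))

stabSize : (n : ℕ) → List (Colour n) → ℕ
stabSize n P =
  length (filterᵇ (λ π → isPerm π ∧ allB (λ C → fixesColour C π) P) (allVecs n n))

IsOrderedPartition : (n : ℕ) → List (Colour n) → Set
IsOrderedPartition n P =
  All (λ C → Σ (Point n) (λ v → C v ≡ true)) P
  × AllPairs (λ C D → (v : Point n) → C v ≡ true → D v ≡ true → ⊥) P
  × ((v : Point n) → Any (λ C → C v ≡ true) P)

-- Partitions of [n] are given by a labelling Q : Fin n → Fin n (parts = nonempty fibres).
Labelling : ℕ → Set
Labelling n = Fin n → Fin n

parts : ∀ {n} → Labelling n → ℕ
parts {n} Q = length (deduplicateᵇ _==F_ (map Q (allFin n)))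

-- A group G ≤ Sym_n given as a (decidable) membership predicate on permutation tables.
-- Q is a supporting partition of G: every π with π(Q') = Q' for all parts Q' lies in G.
Supporting : ∀ {n} → (Perm n → Bool) → Labelling n → Set
Supporting {n} G Q =
  (π : Perm n) → isPerm π ≡ true → ((i : Fin n) → Q (lookup π i) ≡ Q i) → G π ≡ true

Refines : ∀ {n} → Labelling n → Labelling n → Set
Refines {n} Q R = (i j : Fin n) → Q i ≡ Q j → R i ≡ R j

IsSP : ∀ {n} → (Perm n → Bool) → Labelling n → Set
IsSP G Q = Supporting G Q × (∀ Q' → Supporting G Q' → Refines Q' Q)

stabC : ∀ {n} → Colour n → Perm n → Bool
stabC C π = isPerm π ∧ fixesColour C π

IsSPof : ∀ {n} → Colour n → Labelling n → Set
IsSPof C Q = IsSP (stabC C) Q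

{-# OPTIONS --safe #-}
-- A permutation π of [n] is determined by the images π(S₀), …, π(S_{k-1}) of the
-- k = ⌈log₂ n⌉ binary points, S_j having at coordinate i the j-th binary digit of i:
-- these points separate the coordinates, so π⁻¹ is read off digit by digit.  A
-- permutation stabilising every colour class of P maps S_j into the class of S_j,
-- which has at most c·n elements by (2); hence |Stab_n(P)| ≤ (c n)^k = 2^{O(log² n)},
-- which is at most 2^n for large n.  The stated bound only multiplies 2^n by factors ≥ 1,
-- so of the hypotheses only (1) and (2) are used.
module Submission where

open import Defs
open import Data.Empty using (⊥-elim)
open import Data.Bool using (Bool; true; false; _∧_; if_then_else_; T)
import Data.Bool.Properties as Bool
open import Data.Fin using (Fin; zero; suc; inject≤; punchOut; combine; finToFun; funToFin)
open import Data.Fin.Properties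
  using (any?; injective⇒≤; <⇒notInjective; punchOut-injective; inject≤-injective; funToFin-finToFin)
  renaming (_≟_ to _≟F_)
open import Data.List as List
  using (List; []; _∷_; [_]; length; map; _++_; concatMap; cartesianProductWith; filterᵇ; allFin)
open import Data.List.Properties using (length-++; length-map)
open import Data.List.Membership.Propositional using (_∈_; find)
open import Data.List.Membership.Propositional.Properties
  using (∈-lookup; ∈-allFin; ∈-map⁺; ∈-concat⁺′; ∈-filter⁺; ∈-filter⁻; ∈-cartesianProductWith⁺)
import Data.List.Membership.Setoid.Properties as SetoidMembership
open import Data.List.Relation.Unary.All as All using (All; [])
open import Data.List.Relation.Unary.Any as Any using (Any; here; there)
open import Data.List.Relation.Unary.AllPairs using ([]; _∷_)
open import Data.List.Relation.Unary.Unique.Propositional using (Unique)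
import Data.List.Relation.Unary.Unique.Propositional.Properties as Unique
open import Data.Nat
  using (ℕ; zero; suc; _+_; _*_; _^_; _∸_; _≤_; _<_; _!; _≤?_; z<s; s≤s⁻¹)
open import Data.Nat.Logarithm using (⌊log₂_⌋)
open import Data.Nat.Properties
open import Data.Nat.Tactic.RingSolver using (solve-∀)
open import Data.Product using (Σ; ∃; _×_; _,_; proj₁; proj₂; swap)
open import Data.Vec using (Vec; []; _∷_; lookup; tabulate)
open import Data.Vec.Properties using (∷-injective; lookup∘tabulate; tabulate∘lookup; tabulate-cong)
open import Function using (_∘_; Injective; Equivalence)
open import Relation.Binary.PropositionalEquality
  using (_≡_; refl; sym; trans; cong; cong₂; subst; setoid; module ≡-Reasoning)
open import Relation.Nullary using (Dec; yes; no; contradiction)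
open import Relation.Nullary.Decidable using (⌊_⌋; toWitness; isYes≗does; dec-true; T?)

isYes⇒ : ∀ {A : Set} (a? : Dec A) → ⌊ a? ⌋ ≡ true → A
isYes⇒ a? yes! = toWitness (subst T (sym yes!) _)

⇒isYes : ∀ {A : Set} (a? : Dec A) → A → ⌊ a? ⌋ ≡ true
⇒isYes a? a = trans (isYes≗does a?) (dec-true a? a)

∧-true⁻ : ∀ a {b} → a ∧ b ≡ true → a ≡ true × b ≡ true
∧-true⁻ true b≡true = refl , b≡true

allB-sound : ∀ {A : Set} (p : A → Bool) {xs x} → allB p xs ≡ true → x ∈ xs → p x ≡ true
allB-sound p {y ∷ _} ok (here refl) = proj₁ (∧-true⁻ (p y) ok)
allB-sound p {y ∷ _} ok (there x∈) = allB-sound p (proj₂ (∧-true⁻ (p y) ok)) x∈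

module _ {A B : Set} where

  Unique⇒lookup-injective : ∀ {xs : List A} → Unique xs → Injective _≡_ _≡_ (List.lookup xs)
  Unique⇒lookup-injective {_ ∷ _} _          {zero}  {zero}  _  = refl
  Unique⇒lookup-injective {_ ∷ _} (x∉ ∷ _)   {zero}  {suc j} eq = contradiction eq (All.lookup x∉ (∈-lookup j))
  Unique⇒lookup-injective {_ ∷ _} (x∉ ∷ _)   {suc i} {zero}  eq = contradiction (sym eq) (All.lookup x∉ (∈-lookup i))
  Unique⇒lookup-injective {_ ∷ _} (_ ∷ uniq) {suc i} {suc j} eq = cong suc (Unique⇒lookup-injective uniq eq)

  injectiveOn⇒length≤ : ∀ {xs : List A} {ys : List B} (h : A → B) → Unique xs →
    (∀ {x y} → x ∈ xs → y ∈ xs → h x ≡ h y → x ≡ y) →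
    (∀ {x} → x ∈ xs → h x ∈ ys) → length xs ≤ length ys
  injectiveOn⇒length≤ {xs} h uniq h-inj h-into = injective⇒≤ position-injective
    where
    position : Fin (length xs) → Fin _
    position i = Any.index (h-into (∈-lookup i))
    position-injective : Injective _≡_ _≡_ position
    position-injective eq = Unique⇒lookup-injective uniq (h-inj (∈-lookup _) (∈-lookup _)
      (SetoidMembership.index-injective (setoid B) (h-into (∈-lookup _)) (h-into (∈-lookup _)) eq))

  length-cartesianProductWith : ∀ {C : Set} (f : A → B → C) xs ys →
    length (cartesianProductWith f xs ys) ≡ length xs * length ys
  length-cartesianProductWith f []       ys = refl
  length-cartesianProductWith f (x ∷ xs) ys = trans (length-++ (map (f x) ys))
    (cong₂ _+_ (length-map (f x) ys) (length-cartesianProductWith f xs ys))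

  concatMap-map≡cartesianProductWith : ∀ {C : Set} (f : A → B → C) xs ys →
    concatMap (λ x → map (f x) ys) xs ≡ cartesianProductWith f xs ys
  concatMap-map≡cartesianProductWith f []       ys = refl
  concatMap-map≡cartesianProductWith f (x ∷ xs) ys =
    cong (map (f x) ys ++_) (concatMap-map≡cartesianProductWith f xs ys)

vecsIn : ∀ {A : Set} {k} → (Fin k → List A) → List (Vec A k)
vecsIn {k = zero}  L = [ [] ]
vecsIn {k = suc k} L = cartesianProductWith _∷_ (L zero) (vecsIn (L ∘ suc))

∈-vecsIn⁺ : ∀ {A : Set} {k} {L : Fin k → List A} {v : Vec A k} →
  (∀ j → lookup v j ∈ L j) → v ∈ vecsIn L
∈-vecsIn⁺ {v = []}    _   = here refl
∈-vecsIn⁺ {v = x ∷ v} mem = ∈-cartesianProductWith⁺ _∷_ (mem zero) (∈-vecsIn⁺ (mem ∘ suc))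

length-vecsIn : ∀ {A : Set} {k b} (L : Fin k → List A) →
  (∀ j → length (L j) ≤ b) → length (vecsIn L) ≤ b ^ k
length-vecsIn {k = zero}  L short = ≤-refl
length-vecsIn {k = suc k} L short =
  subst (_≤ _) (sym (length-cartesianProductWith _∷_ (L zero) (vecsIn (L ∘ suc))))
    (*-mono-≤ (short zero) (length-vecsIn (L ∘ suc) (short ∘ suc)))

∈-allPoints : ∀ {n} (v : Point n) → v ∈ allPoints n
∈-allPoints []      = here refl
∈-allPoints (b ∷ v) = ∈-concat⁺′ (extend b) (∈-map⁺ _ (∈-allPoints v))
  where
  extend : ∀ b → b ∷ v ∈ (false ∷ v) ∷ (true ∷ v) ∷ []
  extend false = here refl
  extend true  = there (here refl)

Unique-allVecs : ∀ m k → Unique (allVecs m k)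
Unique-allVecs m zero    = [] ∷ []
Unique-allVecs m (suc k) =
  subst Unique (sym (concatMap-map≡cartesianProductWith (λ v i → i ∷ v) (allVecs m k) (allFin m)))
    (Unique.cartesianProductWith⁺ (λ v i → i ∷ v) (swap ∘ ∷-injective)
      (Unique-allVecs m k) (Unique.allFin⁺ m))

injective⇒surjective : ∀ {n} {f : Fin n → Fin n} → Injective _≡_ _≡_ f → ∀ i → ∃ λ j → f j ≡ i
injective⇒surjective {suc m} {f} f-inj i with any? (λ j → f j ≟F i)
... | yes hit  = hit
... | no  miss = ⊥-elim (<⇒notInjective (n<1+n m) squeeze-injective)
  where
  squeeze : Fin (suc m) → Fin m
  squeeze j = punchOut (λ i≡fj → miss (j , sym i≡fj))
  squeeze-injective : Injective _≡_ _≡_ squeeze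
  squeeze-injective eq = f-inj (punchOut-injective {i = i} _ _ eq)

funToFin-cong : ∀ {m n} {f g : Fin m → Fin n} → (∀ j → f j ≡ g j) → funToFin f ≡ funToFin g
funToFin-cong {zero}  _   = refl
funToFin-cong {suc m} f≗g = cong₂ combine (f≗g zero) (funToFin-cong (f≗g ∘ suc))

module _ {n : ℕ} where

  isPerm⇒injective : ∀ (π : Perm n) → isPerm π ≡ true → Injective _≡_ _≡_ (lookup π)
  isPerm⇒injective π ok {i} {j} πi≡πj =
    isYes⇒ (i ≟F j) (subst (λ c → (if c then i ==F j else true) ≡ true)
      (⇒isYes (lookup π i ≟F lookup π j) πi≡πj) pair-ok)
    where
    pair-ok : (if lookup π i ==F lookup π j then i ==F j else true) ≡ true
    pair-ok = allB-sound _ (allB-sound _ ok (∈-allFin i)) (∈-allFin j)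

  findFirst-hit : ∀ (p : Fin n → Bool) d xs → Any (λ j → p j ≡ true) xs → p (findFirst p d xs) ≡ true
  findFirst-hit p d (x ∷ xs) hit with p x in px
  ... | true  = px
  ... | false = findFirst-hit p d xs (Any.tail (Bool.not-¬ px) hit)

  lookup-inv : ∀ (π : Perm n) → isPerm π ≡ true → ∀ i → lookup π (inv π i) ≡ i
  lookup-inv π ok i =
    isYes⇒ (lookup π (inv π i) ≟F i)
      (findFirst-hit (λ j → lookup π j ==F i) i (allFin n) (Any.map (λ {j} → ⇒isYes (lookup π j ≟F i)) preimage∈))
    where
    preimage∈ : Any (λ j → lookup π j ≡ i) (allFin n)
    preimage∈ = let j , πj≡i = injective⇒surjective (isPerm⇒injective π ok) i
                in Any.map (λ { refl → πj≡i }) (∈-allFin j)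

  inv-lookup : ∀ (π : Perm n) → isPerm π ≡ true → ∀ j → inv π (lookup π j) ≡ j
  inv-lookup π ok j = isPerm⇒injective π ok (lookup-inv π ok _)

  inv-injective : ∀ (π σ : Perm n) → isPerm π ≡ true → isPerm σ ≡ true →
    (∀ i → inv π i ≡ inv σ i) → π ≡ σ
  inv-injective π σ π-ok σ-ok inv≗ =
    trans (sym (tabulate∘lookup π)) (trans (tabulate-cong π≗σ) (tabulate∘lookup σ))
    where
    π≗σ : ∀ j → lookup π j ≡ lookup σ j
    π≗σ j = begin
      lookup π j                     ≡⟨ cong (lookup π) (sym (inv-lookup σ σ-ok j)) ⟩
      lookup π (inv σ (lookup σ j))  ≡⟨ cong (lookup π) (sym (inv≗ (lookup σ j))) ⟩
      lookup π (inv π (lookup σ j))  ≡⟨ lookup-inv π π-ok (lookup σ j) ⟩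
      lookup σ j                     ∎
      where open ≡-Reasoning

  lookup-act : ∀ (π : Perm n) v i → lookup (act π v) i ≡ lookup v (inv π i)
  lookup-act π v = lookup∘tabulate _

  fixesColour-sound : ∀ {C : Colour n} {π} → fixesColour C π ≡ true → ∀ v → C v ≡ C (act π v)
  fixesColour-sound {C} {π} ok v = isYes⇒ (C v Bool.≟ C (act π v)) (allB-sound _ ok (∈-allPoints v))

Separating : ∀ {n k} → (Fin k → Point n) → Set
Separating {n} S = ∀ {x y : Fin n} → (∀ j → lookup (S j) x ≡ lookup (S j) y) → x ≡ y

act-injectiveOn-separating : ∀ {n k} {S : Fin k → Point n} {π σ : Perm n} → Separating S →
  isPerm π ≡ true → isPerm σ ≡ true → (∀ j → act π (S j) ≡ act σ (S j)) → π ≡ σ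
act-injectiveOn-separating {S = S} {π} {σ} separating π-ok σ-ok same =
  inv-injective π σ π-ok σ-ok λ i → separating λ j → begin
    lookup (S j) (inv π i)  ≡⟨ sym (lookup-act π (S j) i) ⟩
    lookup (act π (S j)) i  ≡⟨ cong (λ v → lookup v i) (same j) ⟩
    lookup (act σ (S j)) i  ≡⟨ lookup-act σ (S j) i ⟩
    lookup (S j) (inv σ i)  ∎
  where open ≡-Reasoning

bit : Fin 2 → Bool
bit zero       = false
bit (suc zero) = true

bit-injective : Injective _≡_ _≡_ bit
bit-injective {zero}     {zero}     _ = refl
bit-injective {suc zero} {suc zero} _ = refl
bit-injective {zero}     {suc zero} ()
bit-injective {suc zero} {zero}     ()

binaryDigits : ∀ {n} k → n ≤ 2 ^ k → Fin n → Fin k → Fin 2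
binaryDigits k n≤2^k i = finToFun (inject≤ i n≤2^k)

binaryDigits-injective : ∀ {n} k (n≤2^k : n ≤ 2 ^ k) {x y : Fin n} →
  (∀ j → binaryDigits k n≤2^k x j ≡ binaryDigits k n≤2^k y j) → x ≡ y
binaryDigits-injective k n≤2^k {x} {y} same = inject≤-injective n≤2^k n≤2^k x y (begin
  inject≤ x n≤2^k                      ≡⟨ funToFin-finToFin {k} {2} _ ⟨
  funToFin (binaryDigits k n≤2^k x)    ≡⟨ funToFin-cong same ⟩
  funToFin (binaryDigits k n≤2^k y)    ≡⟨ funToFin-finToFin {k} {2} _ ⟩
  inject≤ y n≤2^k                      ∎)
  where open ≡-Reasoning

binaryPoints : ∀ {n} k → n ≤ 2 ^ k → Fin k → Point n
binaryPoints k n≤2^k j = tabulate λ i → bit (binaryDigits k n≤2^k i j)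

binaryPoints-separating : ∀ {n} k (n≤2^k : n ≤ 2 ^ k) → Separating (binaryPoints k n≤2^k)
binaryPoints-separating k n≤2^k {x} {y} same = binaryDigits-injective k n≤2^k λ j →
  bit-injective (trans (sym (lookup∘tabulate _ x)) (trans (same j) (lookup∘tabulate _ y)))

stabilises : ∀ {n} → List (Colour n) → Perm n → Bool
stabilises P π = isPerm π ∧ allB (λ C → fixesColour C π) P

stabSize≤^ : ∀ {n k b} {P : List (Colour n)} {S : Fin k → Point n} →
  (∀ v → Any (λ C → C v ≡ true) P) → (∀ C → C ∈ P → size C ≤ b) → Separating S →
  stabSize n P ≤ b ^ k
stabSize≤^ {n} {k} {b} {P} {S} cover small separating = begin
  stabSize n P                ≤⟨ injectiveOn⇒length≤ images
                                   (Unique.filter⁺ (T? ∘ stabilises P) (Unique-allVecs n n))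
                                   images-injective images-in ⟩
  length (vecsIn elementsOf)  ≤⟨ length-vecsIn elementsOf (λ j → small (classOf j) (classOf∈P j)) ⟩
  b ^ k                       ∎
  where
  open ≤-Reasoning
  classOf : Fin k → Colour n
  classOf j = proj₁ (find (cover (S j)))
  classOf∈P : ∀ j → classOf j ∈ P
  classOf∈P j = proj₁ (proj₂ (find (cover (S j))))
  S∈classOf : ∀ j → classOf j (S j) ≡ true
  S∈classOf j = proj₂ (proj₂ (find (cover (S j))))

  elementsOf : Fin k → List (Point n)
  elementsOf j = filterᵇ (classOf j) (allPoints n)
  stabilisers : List (Perm n)
  stabilisers = filterᵇ (stabilises P) (allVecs n n)
  images : Perm n → Vec (Point n) k
  images π = tabulate λ j → act π (S j)

  stabiliser⁻ : ∀ {π} → π ∈ stabilisers →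
    isPerm π ≡ true × allB (λ C → fixesColour C π) P ≡ true
  stabiliser⁻ {π} π∈ = ∧-true⁻ (isPerm π)
    (Equivalence.to Bool.T-≡ (proj₂ (∈-filter⁻ (T? ∘ stabilises P) {xs = allVecs n n} π∈)))

  images-injective : ∀ {π σ} → π ∈ stabilisers → σ ∈ stabilisers → images π ≡ images σ → π ≡ σ
  images-injective π∈ σ∈ eq = act-injectiveOn-separating {S = S} separating
    (proj₁ (stabiliser⁻ π∈)) (proj₁ (stabiliser⁻ σ∈))
    (λ j → trans (sym (lookup∘tabulate _ j)) (trans (cong (λ w → lookup w j) eq) (lookup∘tabulate _ j)))

  images-in : ∀ {π} → π ∈ stabilisers → images π ∈ vecsIn elementsOf
  images-in {π} π∈ = ∈-vecsIn⁺ λ j → subst (_∈ elementsOf j) (sym (lookup∘tabulate _ j))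
    (∈-filter⁺ (T? ∘ classOf j) (∈-allPoints _) (Equivalence.from Bool.T-≡ (trans
      (sym (fixesColour-sound {π = π} (allB-sound (λ C → fixesColour C π) (proj₂ (stabiliser⁻ π∈))
                                                   (classOf∈P j)) (S j)))
      (S∈classOf j))))

2^k+2^k≡2^[1+k] : ∀ k → 2 ^ k + 2 ^ k ≡ 2 ^ suc k
2^k+2^k≡2^[1+k] k = cong (2 ^ k +_) (sym (+-identityʳ (2 ^ k)))

n<2^n : ∀ n → n < 2 ^ n
n<2^n zero    = z<s
n<2^n (suc n) = begin-strict
  suc n          ≤⟨ n<2^n n ⟩
  2 ^ n          <⟨ m<m+n (2 ^ n) (m^n>0 2 n) ⟩
  2 ^ n + 2 ^ n  ≡⟨ 2^k+2^k≡2^[1+k] n ⟩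
  2 ^ suc n      ∎
  where open ≤-Reasoning

4[16+d]²≤2^[16+d] : ∀ d → 4 * ((16 + d) * (16 + d)) ≤ 2 ^ (16 + d)
4[16+d]²≤2^[16+d] zero    = ≤ᵇ⇒≤ (4 * (16 * 16)) (2 ^ 16) _
4[16+d]²≤2^[16+d] (suc d) = begin
  4 * ((17 + d) * (17 + d))                                         ≤⟨ m≤m+n _ _ ⟩
  4 * ((17 + d) * (17 + d)) + (892 + 120 * d + 4 * (d * d))         ≡⟨ square-step d ⟩
  2 * (4 * ((16 + d) * (16 + d)))                                   ≤⟨ *-monoʳ-≤ 2 (4[16+d]²≤2^[16+d] d) ⟩
  2 ^ (17 + d)                                                      ∎
  where
  open ≤-Reasoning
  square-step : ∀ d → 4 * ((17 + d) * (17 + d)) + (892 + 120 * d + 4 * (d * d))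
                      ≡ 2 * (4 * ((16 + d) * (16 + d)))
  square-step = solve-∀

4k²≤2^k : ∀ {k} → 16 ≤ k → 4 * (k * k) ≤ 2 ^ k
4k²≤2^k {k} 16≤k = subst (λ k → 4 * (k * k) ≤ 2 ^ k) (m+[n∸m]≡n 16≤k) (4[16+d]²≤2^[16+d] (k ∸ 16))

[c+1+k][1+k]≤2^k : ∀ c {k} → c + 16 ≤ k → (c + suc k) * suc k ≤ 2 ^ k
[c+1+k][1+k]≤2^k c {k} c+16≤k = begin
  (c + suc k) * suc k  ≡⟨ cong (_* suc k) (+-suc c k) ⟩
  (suc c + k) * suc k  ≤⟨ *-mono-≤ (+-monoˡ-≤ k (≤-trans (m<m+n c z<s) c+16≤k))
                                   (+-monoˡ-≤ k (≤-trans (m≤m+n 1 15) 16≤k)) ⟩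
  (k + k) * (k + k)    ≡⟨ double-square k ⟩
  4 * (k * k)          ≤⟨ 4k²≤2^k 16≤k ⟩
  2 ^ k                ∎
  where
  open ≤-Reasoning
  16≤k : 16 ≤ k
  16≤k = ≤-trans (m≤n+m 16 c) c+16≤k
  double-square : ∀ k → (k + k) * (k + k) ≡ 4 * (k * k)
  double-square = solve-∀

-- The threshold is c + 16, not 16 + c: 2 ^ (16 + c) reduces to a sum of 2^16 copies of 2 ^ c.
-- k is kept until n reaches 2 ^ k; at that moment n = 2 ^ k ≥ (c + 1 + k)(1 + k), so k + 1 works.
logarithmicExponent-+ : ∀ c d → ∃ λ k →
  c + 16 ≤ k × d + 2 ^ (c + 16) ≤ 2 ^ k × (c + k) * k ≤ d + 2 ^ (c + 16)
logarithmicExponent-+ c zero = c + 16 , ≤-refl , ≤-refl ,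
  ≤-trans (*-mono-≤ (+-monoʳ-≤ c (n≤1+n _)) (n≤1+n _)) ([c+1+k][1+k]≤2^k c ≤-refl)
logarithmicExponent-+ c (suc d) with logarithmicExponent-+ c d
... | k , c+16≤k , n≤2^k , [c+k]k≤n with suc d + 2 ^ (c + 16) ≤? 2 ^ k
...   | yes 1+n≤2^k = k , c+16≤k , 1+n≤2^k , m≤n⇒m≤1+n [c+k]k≤n
...   | no  1+n≰2^k = suc k , m≤n⇒m≤1+n c+16≤k ,
          ≤-trans (+-mono-≤ (m^n>0 2 k) n≤2^k) (≤-reflexive (2^k+2^k≡2^[1+k] k)) ,
          ≤-trans ([c+1+k][1+k]≤2^k c c+16≤k) (m≤n⇒m≤1+n (s≤s⁻¹ (≰⇒> 1+n≰2^k)))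

logarithmicExponent : ∀ c {n} → 2 ^ (c + 16) ≤ n → ∃ λ k → n ≤ 2 ^ k × (c + k) * k ≤ n
logarithmicExponent c {n} N≤n with logarithmicExponent-+ c (n ∸ 2 ^ (c + 16))
... | k , _ , n≤2^k , [c+k]k≤n rewrite m∸n+n≡m N≤n = k , n≤2^k , [c+k]k≤n

[c*n]^k≤2^n : ∀ c {n k} → n ≤ 2 ^ k → (c + k) * k ≤ n → (c * n) ^ k ≤ 2 ^ n
[c*n]^k≤2^n c {n} {k} n≤2^k [c+k]k≤n = begin
  (c * n) ^ k          ≤⟨ ^-monoˡ-≤ k (*-mono-≤ (<⇒≤ (n<2^n c)) n≤2^k) ⟩
  (2 ^ c * 2 ^ k) ^ k  ≡⟨ cong (_^ k) (^-distribˡ-+-* 2 c k) ⟨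
  (2 ^ (c + k)) ^ k    ≡⟨ ^-*-assoc 2 (c + k) k ⟩
  2 ^ ((c + k) * k)    ≤⟨ ^-monoʳ-≤ 2 [c+k]k≤n ⟩
  2 ^ n                ∎
  where open ≤-Reasoning

stabSize≤2^n : ∀ c {n} {P : List (Colour n)} → 2 ^ (c + 16) ≤ n →
  (∀ v → Any (λ C → C v ≡ true) P) → (∀ C → C ∈ P → size C ≤ c * n) → stabSize n P ≤ 2 ^ n
stabSize≤2^n c {n} {P} large cover small with logarithmicExponent c large
... | k , n≤2^k , [c+k]k≤n = begin
  stabSize n P  ≤⟨ stabSize≤^ {S = binaryPoints k n≤2^k} cover small (binaryPoints-separating k n≤2^k) ⟩
  (c * n) ^ k   ≤⟨ [c*n]^k≤2^n c n≤2^k [c+k]k≤n ⟩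
  2 ^ n         ∎
  where open ≤-Reasoning

corollary20 :
    (P : (n : ℕ) → List (Colour n))
    (B : (n : ℕ) → Colour n)
    (f : ℕ → ℕ) →
    -- each P n is an ordered partition of {0,1}^n
    ((n : ℕ) → IsOrderedPartition n (P n)) →
    -- B n is a colour class of P n with |SP(B n)| maximal
    ((n : ℕ) → B n ∈ P n) →
    ((n : ℕ) (C : Colour n) → C ∈ P n → (Q R : Labelling n) →
      IsSPof C Q → IsSPof (B n) R → parts Q ≤ parts R) →
    -- (1) every v occurs in some colour class
    ((n : ℕ) (v : Point n) → Any (λ C → C v ≡ true) (P n)) →
    -- (2) max |C| ∈ O(n)
    Σ ℕ (λ c → Σ ℕ (λ N → (n : ℕ) → N ≤ n → (C : Colour n) → C ∈ P n →
      size C ≤ c * n)) →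
    -- (3) |SP(B n)| ∈ o(n)
    ((k : ℕ) → Σ ℕ (λ N → (n : ℕ) → N ≤ n → (R : Labelling n) →
      IsSPof (B n) R → k * parts R ≤ n)) →
    -- f ∈ o(n)
    ((k : ℕ) → Σ ℕ (λ N → (n : ℕ) → N ≤ n → k * f n ≤ n)) →
    -- |SP(C)| ≤ f n for all C ∈ P n, for large n
    Σ ℕ (λ N → (n : ℕ) → N ≤ n → (C : Colour n) → C ∈ P n →
      (Q : Labelling n) → IsSPof C Q → parts Q ≤ f n) →
    -- conclusion: |Stab| ≤ (f!)^(n/(f-1)) · 2^n · (⌊8 log n⌋)!, denominators cleared
    Σ ℕ (λ N → (n : ℕ) → N ≤ n →
      stabSize n (P n) ^ (f n ∸ 1)
        ≤ (f n !) ^ n * ((2 ^ n) * (⌊log₂ (n ^ 8) ⌋) !) ^ (f n ∸ 1))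
corollary20 P _ f _ _ _ cover (c , N₀ , small) _ _ _ = N₀ + 2 ^ (c + 16) , λ n N≤n →
  let L = ⌊log₂ (n ^ 8) ⌋ in begin
  stabSize n (P n) ^ (f n ∸ 1)             ≤⟨ ^-monoˡ-≤ (f n ∸ 1) (stabSize≤2^n c (≤-trans (m≤n+m _ N₀) N≤n)
                                                (cover n) (small n (≤-trans (m≤m+n N₀ _) N≤n))) ⟩
  (2 ^ n) ^ (f n ∸ 1)                      ≤⟨ ^-monoˡ-≤ (f n ∸ 1) (m≤m*n (2 ^ n) (L !) {{L !≢0}}) ⟩
  (2 ^ n * L !) ^ (f n ∸ 1)                ≤⟨ m≤n*m _ ((f n !) ^ n) {{m^n≢0 (f n !) n {{f n !≢0}}}} ⟩
  (f n !) ^ n * (2 ^ n * L !) ^ (f n ∸ 1)  ∎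
  where open ≤-Reasoning
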